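{- Let $n\ge 4$ be even and $a,b$ odd with $0<a<b<n$. The subgraph of $\mathcal{M}_O(n,a,b)$ induced on $V=\{v_0,\dots,v_{n-1}\}$ is a cycle through all vertices of $V$ if and only if $\gcd(b-a,n)=2$.
   Context: $\mathcal{M}_O(n,a,b)$ has vertices $u_0,\dots,u_{n-1},v_0,\dots,v_{n-1}$ and edges $[u_i,u_{i+1}]$ and $[u_i,v_i]$ for all $i$, and $[v_i,v_{i+a}]$, $[v_i,v_{i+b}]$ for all even $i$, subscripts modulo $n$. -}

module Defs where

open import Data.Nat using (ℕ; suc; _+_; _%_; NonZero)
open import Data.Nat.Divisibility using (_∣_)
open import Data.Fin using (Fin; toℕ)
open import Data.Product using (_×_; ∃; ∃-syntax)
open import Data.Sum using (_⊎_)
open import Function.Bundles using (_⇔_)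
open import Function.Definitions using (Injective)
open import Relation.Binary.PropositionalEquality using (_≡_)

-- The vertex v_i of M_O(n,a,b) is represented by i : Fin n.
-- Directed "generating" edge of the induced subgraph on V:
-- [v_i, v_{i+a}] or [v_i, v_{i+b}] for even i (subscripts mod n).
GenEdge : (n a b : ℕ) → .{{_ : NonZero n}} → Fin n → Fin n → Set
GenEdge n a b x y =
  (2 ∣ toℕ x) × (toℕ y ≡ (toℕ x + a) % n ⊎ toℕ y ≡ (toℕ x + b) % n)

VAdj : (n a b : ℕ) → .{{_ : NonZero n}} → Fin n → Fin n → Set
VAdj n a b x y = GenEdge n a b x y ⊎ GenEdge n a b y x

Consecutive : (n : ℕ) → .{{_ : NonZero n}} → (Fin n → Fin n) → Fin n → Fin n → Set
Consecutive n f x y =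
  ∃[ k ] ∃[ k' ] (toℕ k' ≡ suc (toℕ k) % n × x ≡ f k × y ≡ f k')

IsHamiltonianCycleGraph : (n : ℕ) → .{{_ : NonZero n}} → (Fin n → Fin n → Set) → Set
IsHamiltonianCycleGraph n Adj =
  ∃[ f ] (Injective _≡_ _≡_ f ×
    (∀ x y → Adj x y ⇔ (Consecutive n f x y ⊎ Consecutive n f y x)))

module Submission where

-- An even vertex v_i is adjacent to v_{i+a} and v_{i+b}, an odd vertex v_j to v_{j-a} and
-- v_{j-b}, so the graph is 2-regular. Alternately taking a b-edge forwards and an a-edge
-- backwards traces the closed walk v_0, v_b, v_c, v_{c+b}, v_{2c}, ... with c = b - a, which
-- passes through every vertex exactly when the multiples of c exhaust the even residues mod n,
-- i.e. when gcd(c, n) = 2. Conversely, for D = gcd(c, n) every edge preserves the class of v_t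
-- modulo D, namely t for even t and t - a for odd t; v_0 and v_2 lie in different classes as
-- soon as D > 2, so the graph is then not even connected.

open import Defs
open import Data.Nat using (ℕ; _∸_; _≤_; _<_; NonZero)
open import Data.Nat.Divisibility using (_∣_)
open import Data.Nat.GCD using (gcd)
open import Data.Product using (_×_)
open import Function.Bundles using (_⇔_)
open import Relation.Nullary using (¬_)
open import Relation.Binary.PropositionalEquality using (_≡_)

open import Data.Empty using (⊥-elim)
open import Data.Fin using (Fin; toℕ; fromℕ<; punchOut)
open import Data.Fin.Properties
  using (toℕ-fromℕ<; fromℕ<-toℕ; toℕ-injective; toℕ<n; any?; punchOut-injective; injective⇒≤)
  renaming (_≟_ to _≟ᶠ_)
open import Data.Nat
open import Data.Nat.DivMod
open import Data.Nat.Divisibility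
open import Data.Nat.GCD
open import Data.Nat.Properties
open import Data.Product using (∃; _,_)
open import Data.Sum using (_⊎_; inj₁; inj₂; swap; [_,_]′)
open import Function.Base using (_∘_)
open import Function.Bundles using (mk⇔; module Equivalence)
open import Function.Definitions using (Injective)
open import Relation.Nullary using (yes; no)
open import Relation.Binary.PropositionalEquality
open ≡-Reasoning

injective⇒surjective : ∀ {m} (f : Fin m → Fin m) → Injective _≡_ _≡_ f → ∀ y → ∃ λ x → f x ≡ y
injective⇒surjective {zero} f _ ()
injective⇒surjective {suc m} f f-inj y with any? (λ x → f x ≟ᶠ y)
... | yes hit = hit
... | no miss = ⊥-elim (<-irrefl refl (injective⇒≤ {f = f′} f′-inj))
  where
  f′ : Fin (suc m) → Fin m
  f′ x = punchOut (λ y≡fx → miss (x , sym y≡fx))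
  f′-inj : Injective _≡_ _≡_ f′
  f′-inj eq = f-inj (punchOut-injective {i = y} _ _ eq)

%2≡0⊎%2≡1 : ∀ m → m % 2 ≡ 0 ⊎ m % 2 ≡ 1
%2≡0⊎%2≡1 zero = inj₁ refl
%2≡0⊎%2≡1 (suc zero) = inj₂ refl
%2≡0⊎%2≡1 (suc (suc m)) = %2≡0⊎%2≡1 m

odd⇒%2≡1 : ∀ {m} → ¬ 2 ∣ m → m % 2 ≡ 1
odd⇒%2≡1 {m} m-odd with %2≡0⊎%2≡1 m
... | inj₁ m-even = ⊥-elim (m-odd (m%n≡0⇒n∣m m 2 m-even))
... | inj₂ m-odd′ = m-odd′

%2≡1⇒[1+m]%2≡0 : ∀ m → m % 2 ≡ 1 → suc m % 2 ≡ 0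
%2≡1⇒[1+m]%2≡0 (suc zero) _ = refl
%2≡1⇒[1+m]%2≡0 (suc (suc m)) m-odd = %2≡1⇒[1+m]%2≡0 m m-odd

[m+n]%2≡1 : ∀ m n → m % 2 ≡ 0 → n % 2 ≡ 1 → (m + n) % 2 ≡ 1
[m+n]%2≡1 m n m-even n-odd =
  trans (%-distribˡ-+ m n 2) (cong₂ (λ p q → (p + q) % 2) m-even n-odd)

%-congˡ-+ : ∀ {m n} k d .{{_ : NonZero d}} → m % d ≡ n % d → (m + k) % d ≡ (n + k) % d
%-congˡ-+ {m} {n} k d eq = begin
  (m + k) % d           ≡⟨ %-distribˡ-+ m k d ⟩
  (m % d + k % d) % d   ≡⟨ cong (λ r → (r + k % d) % d) eq ⟩
  (n % d + k % d) % d   ≡⟨ %-distribˡ-+ n k d ⟨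
  (n + k) % d           ∎

[m%d+n]%d≡[m+n]%d : ∀ m n d .{{_ : NonZero d}} → (m % d + n) % d ≡ (m + n) % d
[m%d+n]%d≡[m+n]%d m n d = %-congˡ-+ n d (m%n%n≡m%n m d)

[m+n]%d≡m%d⇒d∣n : ∀ m n d .{{_ : NonZero d}} → (m + n) % d ≡ m % d → d ∣ n
[m+n]%d≡m%d⇒d∣n m n d eq = divides ((r + n) / d) (+-cancelˡ-≡ r n _ r+n≡r+q*d)
  where
  r : ℕ
  r = m % d
  r+n≡r+q*d : r + n ≡ r + (r + n) / d * d
  r+n≡r+q*d = begin
    r + n                           ≡⟨ m≡m%n+[m/n]*n (r + n) d ⟩
    (r + n) % d + (r + n) / d * d   ≡⟨ cong (_+ (r + n) / d * d) (trans ([m%d+n]%d≡[m+n]%d m n d) eq) ⟩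
    r + (r + n) / d * d             ∎

m<n∧n∣m⇒m≡0 : ∀ {m n} .{{_ : NonZero n}} → m < n → n ∣ m → m ≡ 0
m<n∧n∣m⇒m≡0 {m} {n} m<n n∣m = trans (sym (m<n⇒m%n≡m m<n)) (n∣m⇒m%n≡0 m n n∣m)

≡-mod⇒≡ : ∀ {m n} d .{{_ : NonZero d}} → m ≤ n → n ∸ m < d → m % d ≡ n % d → m ≡ n
≡-mod⇒≡ {m} {n} d m≤n gap<d eq = ≤-antisym m≤n (m∸n≡0⇒m≤n (m<n∧n∣m⇒m≡0 gap<d d∣gap))
  where
  d∣gap : d ∣ n ∸ m
  d∣gap = [m+n]%d≡m%d⇒d∣n m (n ∸ m) d (trans (cong (_% d) (m+[n∸m]≡n m≤n)) (sym eq))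

+-cancelʳ-≡-mod : ∀ {u v} k n .{{_ : NonZero n}} → u < n → v < n →
                  (u + k) % n ≡ (v + k) % n → u ≡ v
+-cancelʳ-≡-mod {u} {v} k n u<n v<n eq =
  [ (λ u≤v → cancel u≤v v<n eq) , (λ v≤u → sym (cancel v≤u u<n (sym eq))) ]′ (≤-total u v)
  where
  cancel : ∀ {u v} → u ≤ v → v < n → (u + k) % n ≡ (v + k) % n → u ≡ v
  cancel {u} {v} u≤v v<n eq = +-cancelʳ-≡ k u v (≡-mod⇒≡ n (+-monoˡ-≤ k u≤v) gap<n eq)
    where
    gap<n : (v + k) ∸ (u + k) < n
    gap<n = ≤-<-trans (≤-reflexive (begin
      (v + k) ∸ (u + k)  ≡⟨ cong₂ _∸_ (+-comm v k) (+-comm u k) ⟩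
      (k + v) ∸ (k + u)  ≡⟨ [m+n]∸[m+o]≡n∸o k v u ⟩
      v ∸ u              ∎)) (≤-<-trans (m∸n≤m v u) v<n)

hamiltonian⇒invariant-constant : ∀ {n} .{{_ : NonZero n}} {Adj : Fin n → Fin n → Set} {A : Set}
  (φ : Fin n → A) → (∀ {x y} → Adj x y → φ x ≡ φ y) →
  IsHamiltonianCycleGraph n Adj → ∀ x y → φ x ≡ φ y
hamiltonian⇒invariant-constant {n} {Adj} φ φ-resp (f , f-inj , adj⇔consecutive) x y =
  trans (φ≡φ-start x) (sym (φ≡φ-start y))
  where
  start : Fin n
  start = f (fromℕ< (>-nonZero⁻¹ n))

  φ-along : ∀ j (j<n : j < n) → φ (f (fromℕ< j<n)) ≡ φ start
  φ-along zero _ = refl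
  φ-along (suc j) 1+j<n = trans (sym (φ-resp adjacent)) (φ-along j j<n)
    where
    j<n : j < n
    j<n = <-trans (n<1+n j) 1+j<n
    consecutive : Consecutive n f (f (fromℕ< j<n)) (f (fromℕ< 1+j<n))
    consecutive = _ , _ , (begin
      toℕ (fromℕ< 1+j<n)        ≡⟨ toℕ-fromℕ< 1+j<n ⟩
      suc j                     ≡⟨ m<n⇒m%n≡m 1+j<n ⟨
      suc j % n                 ≡⟨ cong (λ i → suc i % n) (toℕ-fromℕ< j<n) ⟨
      suc (toℕ (fromℕ< j<n)) % n ∎) , refl , refl
    adjacent : Adj (f (fromℕ< j<n)) (f (fromℕ< 1+j<n))
    adjacent = Equivalence.from (adj⇔consecutive _ _) (inj₁ consecutive)

  φ≡φ-start : ∀ x → φ x ≡ φ start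
  φ≡φ-start x with injective⇒surjective f f-inj x
  ... | k , refl = trans (cong (φ ∘ f) (sym (fromℕ<-toℕ k (toℕ<n k)))) (φ-along (toℕ k) (toℕ<n k))

module OddCirculant (n a b : ℕ) .{{_ : NonZero n}}
  (2∣n : 2 ∣ n) (a-odd : ¬ 2 ∣ a) (b-odd : ¬ 2 ∣ b) (a≤b : a ≤ b) where

  c : ℕ
  c = b ∸ a

  c+a≡b : c + a ≡ b
  c+a≡b = m∸n+n≡m a≤b

  2∣c : 2 ∣ c
  2∣c = [m+n]%d≡m%d⇒d∣n a c 2 (begin
    (a + c) % 2  ≡⟨ cong (_% 2) (trans (+-comm a c) c+a≡b) ⟩
    b % 2        ≡⟨ odd⇒%2≡1 b-odd ⟩
    1            ≡⟨ odd⇒%2≡1 a-odd ⟨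
    a % 2        ∎)

  %n%2≡%2 : ∀ m → m % n % 2 ≡ m % 2
  %n%2≡%2 m = m∣n⇒o%n%m≡o%m 2 n m 2∣n

  walk : ℕ → ℕ
  walk zero = 0
  walk (suc zero) = b
  walk (suc (suc j)) = c + walk j

  walk-even-step : ∀ j → j % 2 ≡ 0 → walk (suc j) ≡ walk j + b
  walk-even-step zero _ = refl
  walk-even-step (suc (suc j)) j-even =
    trans (cong (c +_) (walk-even-step j j-even)) (sym (+-assoc c (walk j) b))

  walk-odd-step : ∀ j → j % 2 ≡ 1 → walk (suc j) + a ≡ walk j
  walk-odd-step (suc zero) _ = trans (cong (_+ a) (+-identityʳ c)) c+a≡b
  walk-odd-step (suc (suc j)) j-odd =
    trans (+-assoc c (walk (suc j)) a) (cong (c +_) (walk-odd-step j j-odd))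

  walk-parity : ∀ j → walk j % 2 ≡ j % 2
  walk-parity zero = refl
  walk-parity (suc zero) = odd⇒%2≡1 b-odd
  walk-parity (suc (suc j)) = trans (%-remove-+ˡ (walk j) 2∣c) (walk-parity j)

  walk-shift : ∀ d j → walk (d * 2 + j) ≡ d * c + walk j
  walk-shift zero j = refl
  walk-shift (suc d) j = trans (cong (c +_) (walk-shift d j)) (sym (+-assoc c (d * c) (walk j)))

  walk-periodic : ∀ q j → walk (q * n + j) % n ≡ walk j % n
  walk-periodic q j = begin
    walk (q * n + j) % n         ≡⟨ cong (λ i → walk (i + j) % n) q*n≡q*h*2 ⟩
    walk (q * h * 2 + j) % n     ≡⟨ cong (_% n) (walk-shift (q * h) j) ⟩
    (q * h * c + walk j) % n     ≡⟨ %-remove-+ˡ (walk j) n∣q*h*c ⟩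
    walk j % n                   ∎
    where
    h : ℕ
    h = quotient 2∣n
    q*n≡q*h*2 : q * n ≡ q * h * 2
    q*n≡q*h*2 = trans (cong (q *_) (m∣n⇒n≡quotient*m 2∣n)) (sym (*-assoc q h 2))
    n∣q*h*c : n ∣ q * h * c
    n∣q*h*c = subst₂ _∣_ (sym (m∣n⇒n≡quotient*m 2∣n)) (sym (*-assoc q h c))
                (∣n⇒∣m*n q (*-monoʳ-∣ h 2∣c))

  walk-mod : ∀ j → walk (j % n) % n ≡ walk j % n
  walk-mod j = begin
    walk (j % n) % n              ≡⟨ walk-periodic (j / n) (j % n) ⟨
    walk (j / n * n + j % n) % n  ≡⟨ cong (λ i → walk i % n) (trans (+-comm _ (j % n)) (sym (m≡m%n+[m/n]*n j n))) ⟩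
    walk j % n                    ∎

  listing : Fin n → Fin n
  listing k = fromℕ< (m%n<n (walk (toℕ k)) n)

  next : Fin n → Fin n
  next k = fromℕ< (m%n<n (suc (toℕ k)) n)

  toℕ-listing : ∀ k → toℕ (listing k) ≡ walk (toℕ k) % n
  toℕ-listing k = toℕ-fromℕ< _

  toℕ-listing-next : ∀ k → toℕ (listing (next k)) ≡ walk (suc (toℕ k)) % n
  toℕ-listing-next k = trans (toℕ-listing (next k))
    (trans (cong (λ i → walk i % n) (toℕ-fromℕ< (m%n<n (suc (toℕ k)) n))) (walk-mod (suc (toℕ k))))

  listing-parity : ∀ k → toℕ (listing k) % 2 ≡ toℕ k % 2
  listing-parity k = trans (cong (_% 2) (toℕ-listing k)) (trans (%n%2≡%2 _) (walk-parity (toℕ k)))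

  listing-next-from-even : ∀ k → toℕ k % 2 ≡ 0 → toℕ (listing (next k)) ≡ (toℕ (listing k) + b) % n
  listing-next-from-even k k-even = begin
    toℕ (listing (next k))       ≡⟨ toℕ-listing-next k ⟩
    walk (suc (toℕ k)) % n       ≡⟨ cong (_% n) (walk-even-step (toℕ k) k-even) ⟩
    (walk (toℕ k) + b) % n       ≡⟨ [m%d+n]%d≡[m+n]%d _ b n ⟨
    (walk (toℕ k) % n + b) % n   ≡⟨ cong (λ i → (i + b) % n) (toℕ-listing k) ⟨
    (toℕ (listing k) + b) % n    ∎

  listing-next-from-odd : ∀ k → toℕ k % 2 ≡ 1 → toℕ (listing k) ≡ (toℕ (listing (next k)) + a) % n
  listing-next-from-odd k k-odd = begin
    toℕ (listing k)                     ≡⟨ toℕ-listing k ⟩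
    walk (toℕ k) % n                    ≡⟨ cong (_% n) (walk-odd-step (toℕ k) k-odd) ⟨
    (walk (suc (toℕ k)) + a) % n        ≡⟨ [m%d+n]%d≡[m+n]%d _ a n ⟨
    (walk (suc (toℕ k)) % n + a) % n    ≡⟨ cong (λ i → (i + a) % n) (toℕ-listing-next k) ⟨
    (toℕ (listing (next k)) + a) % n    ∎

  listing-next-adjacent : ∀ k → VAdj n a b (listing k) (listing (next k))
  listing-next-adjacent k with %2≡0⊎%2≡1 (toℕ k)
  ... | inj₁ k-even = inj₁ (2∣listing-k , inj₂ (listing-next-from-even k k-even))
    where
    2∣listing-k : 2 ∣ toℕ (listing k)
    2∣listing-k = m%n≡0⇒n∣m _ 2 (trans (listing-parity k) k-even)
  ... | inj₂ k-odd = inj₂ (2∣listing-next-k , inj₁ (listing-next-from-odd k k-odd))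
    where
    2∣listing-next-k : 2 ∣ toℕ (listing (next k))
    2∣listing-next-k = m%n≡0⇒n∣m _ 2 (trans (listing-parity (next k))
      (trans (cong (_% 2) (toℕ-fromℕ< (m%n<n (suc (toℕ k)) n)))
        (trans (%n%2≡%2 (suc (toℕ k))) (%2≡1⇒[1+m]%2≡0 (toℕ k) k-odd))))

  listing-consecutive⇒adjacent : ∀ {x y} → Consecutive n listing x y → VAdj n a b x y
  listing-consecutive⇒adjacent (k , k′ , k′≡1+k , refl , refl) =
    subst (VAdj n a b (listing k) ∘ listing) (sym k′≡next) (listing-next-adjacent k)
    where
    k′≡next : k′ ≡ next k
    k′≡next = toℕ-injective (trans k′≡1+k (sym (toℕ-fromℕ< _)))

  module _ (gcd≡2 : gcd c n ≡ 2) where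

    walk-injective-mod : ∀ {i j} → i ≤ j → j < n → walk i % n ≡ walk j % n → i ≡ j
    walk-injective-mod {i} {j} i≤j j<n walk-i≡walk-j =
      ≤-antisym i≤j (m∸n≡0⇒m≤n (m<n∧n∣m⇒m≡0 (≤-<-trans (m∸n≤m j i) j<n) n∣gap))
      where
      gap : ℕ
      gap = j ∸ i
      i+gap≡j : i + gap ≡ j
      i+gap≡j = m+[n∸m]≡n i≤j
      2∣gap : 2 ∣ gap
      2∣gap = [m+n]%d≡m%d⇒d∣n i gap 2 (begin
        (i + gap) % 2     ≡⟨ cong (_% 2) i+gap≡j ⟩
        j % 2             ≡⟨ walk-parity j ⟨
        walk j % 2        ≡⟨ %n%2≡%2 (walk j) ⟨
        walk j % n % 2    ≡⟨ cong (_% 2) walk-i≡walk-j ⟨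
        walk i % n % 2    ≡⟨ %n%2≡%2 (walk i) ⟩
        walk i % 2        ≡⟨ walk-parity i ⟩
        i % 2             ∎)
      h : ℕ
      h = quotient 2∣gap
      gap≡h*2 : gap ≡ h * 2
      gap≡h*2 = m∣n⇒n≡quotient*m 2∣gap
      n∣h*c : n ∣ h * c
      n∣h*c = [m+n]%d≡m%d⇒d∣n (walk i) (h * c) n (begin
        (walk i + h * c) % n  ≡⟨ cong (_% n) (trans (+-comm (walk i) (h * c)) (sym (walk-shift h i))) ⟩
        walk (h * 2 + i) % n  ≡⟨ cong (λ l → walk (l + i) % n) gap≡h*2 ⟨
        walk (gap + i) % n    ≡⟨ cong (λ l → walk l % n) (trans (+-comm gap i) i+gap≡j) ⟩
        walk j % n            ≡⟨ walk-i≡walk-j ⟨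
        walk i % n            ∎)
      -- n divides h·c and h·n, hence h · gcd(c, n) = 2h = gap
      n∣gap : n ∣ gap
      n∣gap = subst (n ∣_) (trans (sym (c*gcd[m,n]≡gcd[cm,cn] h c n)) (trans (cong (h *_) gcd≡2) (sym gap≡h*2)))
                (gcd-greatest n∣h*c (n∣m*n h))

    listing-injective : Injective _≡_ _≡_ listing
    listing-injective {k} {k′} listing-k≡listing-k′ = toℕ-injective
      ([ (λ k≤k′ → walk-injective-mod k≤k′ (toℕ<n k′) walk≡)
       , (λ k′≤k → sym (walk-injective-mod k′≤k (toℕ<n k) (sym walk≡))) ]′ (≤-total (toℕ k) (toℕ k′)))
      where
      walk≡ : walk (toℕ k) % n ≡ walk (toℕ k′) % n
      walk≡ = trans (sym (toℕ-listing k)) (trans (cong toℕ listing-k≡listing-k′) (toℕ-listing k′))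

    edge⇒consecutive : ∀ {x y} → GenEdge n a b x y → Consecutive n listing x y ⊎ Consecutive n listing y x
    edge⇒consecutive {x} (2∣x , inj₂ y≡x+b) with injective⇒surjective listing listing-injective x
    ... | k , refl = inj₁ (k , next k , toℕ-fromℕ< _ , refl ,
                           toℕ-injective (trans y≡x+b (sym (listing-next-from-even k k-even))))
      where
      k-even : toℕ k % 2 ≡ 0
      k-even = trans (sym (listing-parity k)) (n∣m⇒m%n≡0 _ 2 2∣x)
    edge⇒consecutive {x} {y} (2∣x , inj₁ y≡x+a) with injective⇒surjective listing listing-injective y
    ... | k , refl = inj₂ (k , next k , toℕ-fromℕ< _ , refl ,
                           toℕ-injective (+-cancelʳ-≡-mod a n (toℕ<n x) (toℕ<n _)
                             (trans (sym y≡x+a) (listing-next-from-odd k k-odd))))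
      where
      k-odd : toℕ k % 2 ≡ 1
      k-odd = trans (sym (listing-parity k)) (trans (cong (_% 2) y≡x+a)
        (trans (%n%2≡%2 _) ([m+n]%2≡1 (toℕ x) a (n∣m⇒m%n≡0 _ 2 2∣x) (odd⇒%2≡1 a-odd))))

    listing-hamiltonian : IsHamiltonianCycleGraph n (VAdj n a b)
    listing-hamiltonian = listing , listing-injective , λ _ _ → mk⇔ adjacent⇒consecutive consecutive⇒adjacent
      where
      adjacent⇒consecutive : ∀ {x y} → VAdj n a b x y → Consecutive n listing x y ⊎ Consecutive n listing y x
      adjacent⇒consecutive (inj₁ edge) = edge⇒consecutive edge
      adjacent⇒consecutive (inj₂ edge) = swap (edge⇒consecutive edge)
      consecutive⇒adjacent : ∀ {x y} → Consecutive n listing x y ⊎ Consecutive n listing y x → VAdj n a b x y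
      consecutive⇒adjacent (inj₁ xy) = listing-consecutive⇒adjacent xy
      consecutive⇒adjacent (inj₂ yx) = swap (listing-consecutive⇒adjacent yx)

  module _ (a<n : a < n) {D} .{{_ : NonZero D}} (D∣c : D ∣ c) (D∣n : D ∣ n) where

    class : ℕ → ℕ
    class t = (t + t % 2 * (n ∸ a)) % D

    class-edge : ∀ {s t e} → s % 2 ≡ 0 → e % 2 ≡ 1 → t ≡ (s + e) % n → D ∣ e + (n ∸ a) →
                 class t ≡ class s
    class-edge {s} {t} {e} s-even e-odd t≡s+e D∣e+n∸a = begin
      (t + t % 2 * (n ∸ a)) % D  ≡⟨ cong (λ p → (t + p * (n ∸ a)) % D) t-odd ⟩
      (t + 1 * (n ∸ a)) % D      ≡⟨ cong (λ m → (t + m) % D) (*-identityˡ (n ∸ a)) ⟩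
      (t + (n ∸ a)) % D          ≡⟨ %-congˡ-+ (n ∸ a) D t≡s+e-mod-D ⟩
      (s + e + (n ∸ a)) % D      ≡⟨ cong (_% D) (+-assoc s e (n ∸ a)) ⟩
      (s + (e + (n ∸ a))) % D    ≡⟨ %-remove-+ʳ s D∣e+n∸a ⟩
      s % D                      ≡⟨ cong (_% D) (+-identityʳ s) ⟨
      (s + 0) % D                ≡⟨ cong (λ p → (s + p * (n ∸ a)) % D) s-even ⟨
      (s + s % 2 * (n ∸ a)) % D  ∎
      where
      t-odd : t % 2 ≡ 1
      t-odd = trans (cong (_% 2) t≡s+e) (trans (%n%2≡%2 (s + e)) ([m+n]%2≡1 s e s-even e-odd))
      t≡s+e-mod-D : t % D ≡ (s + e) % D
      t≡s+e-mod-D = trans (cong (_% D) t≡s+e) (m∣n⇒o%n%m≡o%m D n (s + e) D∣n)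

    class-along-edge : ∀ {x y} → GenEdge n a b x y → class (toℕ y) ≡ class (toℕ x)
    class-along-edge (2∣x , inj₁ y≡x+a) =
      class-edge (n∣m⇒m%n≡0 _ 2 2∣x) (odd⇒%2≡1 a-odd) y≡x+a (subst (D ∣_) (sym a+[n∸a]≡n) D∣n)
      where
      a+[n∸a]≡n : a + (n ∸ a) ≡ n
      a+[n∸a]≡n = m+[n∸m]≡n (<⇒≤ a<n)
    class-along-edge (2∣x , inj₂ y≡x+b) =
      class-edge (n∣m⇒m%n≡0 _ 2 2∣x) (odd⇒%2≡1 b-odd) y≡x+b (subst (D ∣_) (sym b+[n∸a]≡c+n) (∣m∣n⇒∣m+n D∣c D∣n))
      where
      b+[n∸a]≡c+n : b + (n ∸ a) ≡ c + n
      b+[n∸a]≡c+n = begin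
        b + (n ∸ a)        ≡⟨ cong (_+ (n ∸ a)) c+a≡b ⟨
        c + a + (n ∸ a)    ≡⟨ +-assoc c a (n ∸ a) ⟩
        c + (a + (n ∸ a))  ≡⟨ cong (c +_) (m+[n∸m]≡n (<⇒≤ a<n)) ⟩
        c + n              ∎

    class-adjacent : ∀ {x y} → VAdj n a b x y → class (toℕ x) ≡ class (toℕ y)
    class-adjacent (inj₁ edge) = sym (class-along-edge edge)
    class-adjacent (inj₂ edge) = class-along-edge edge

    not-hamiltonian : 2 < D → 2 < n → ¬ IsHamiltonianCycleGraph n (VAdj n a b)
    not-hamiltonian 2<D 2<n hamiltonian = 0≢2 (begin
      0                      ≡⟨ m<n⇒m%n≡m (<-trans z<s 2<D) ⟨
      class 0                ≡⟨ cong class (toℕ-fromℕ< (>-nonZero⁻¹ n)) ⟨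
      class (toℕ v₀)         ≡⟨ hamiltonian⇒invariant-constant (class ∘ toℕ) class-adjacent hamiltonian v₀ v₂ ⟩
      class (toℕ v₂)         ≡⟨ cong class (toℕ-fromℕ< 2<n) ⟩
      class 2                ≡⟨ m<n⇒m%n≡m 2<D ⟩
      2                      ∎)
      where
      v₀ v₂ : Fin n
      v₀ = fromℕ< (>-nonZero⁻¹ n)
      v₂ = fromℕ< 2<n
      0≢2 : 0 ≢ 2
      0≢2 ()

  hamiltonian⇒gcd≡2 : a < n → 2 < n → IsHamiltonianCycleGraph n (VAdj n a b) → gcd c n ≡ 2
  hamiltonian⇒gcd≡2 a<n 2<n hamiltonian =
    [ (λ 2<gcd → ⊥-elim (not-hamiltonian a<n (gcd[m,n]∣m c n) (gcd[m,n]∣n c n) 2<gcd 2<n hamiltonian))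
    , sym ]′ (m≤n⇒m<n∨m≡n (∣⇒≤ (gcd-greatest 2∣c 2∣n)))
    where
    instance
      gcd≢0 : NonZero (gcd c n)
      gcd≢0 = ≢-nonZero (gcd[m,n]≢0 c n (inj₂ (≢-nonZero⁻¹ n)))

lemma4p1 : (n a b : ℕ) → .{{_ : NonZero n}} → 4 ≤ n → 2 ∣ n → ¬ (2 ∣ a) → ¬ (2 ∣ b) →
    0 < a → a < b → b < n →
    (IsHamiltonianCycleGraph n (VAdj n a b) ⇔ gcd (b ∸ a) n ≡ 2)
lemma4p1 n a b 4≤n 2∣n a-odd b-odd _ a<b b<n =
  mk⇔ (hamiltonian⇒gcd≡2 (<-trans a<b b<n) (≤-trans (n≤1+n 3) 4≤n)) listing-hamiltonian
  where
  open OddCirculant n a b 2∣n a-odd b-odd (<⇒≤ a<b)
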